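{- Let $n\ge 8$ be even and let $G_n$ be the complement of the disjoint union of two cycles each of length $n/2$. No set of integers containing $0$ is a signature for $G_n$.
   Context: A finite simple graph $G=(V,E)$ has signature $S$ (a finite multiset of integers) if there is a bijection $\pi$ from the elements of $S$ to $V$ such that for any two distinct elements $s,t$ of $S$, $\pi(s)$ and $\pi(t)$ are adjacent iff $|s-t|\in S$. -}

module Defs where

open import Data.Nat using (ℕ; zero; suc)
open import Data.Fin using (Fin; toℕ)
open import Data.Integer using (ℤ; _-_; ∣_∣; +_)
open import Data.List using (List; length; lookup)
open import Data.List.Membership.Propositional using (_∈_)
open import Data.Product using (Σ; _×_; _,_; proj₁; proj₂)
open import Data.Sum using (_⊎_)
open import Relation.Binary.PropositionalEquality using (_≡_; _≢_)
open import Relation.Nullary using (¬_)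
open import Function.Bundles using (_↔_; Inverse; _⇔_)

record Graph (V : Set) : Set₁ where
  field
    Adj       : V → V → Set
    Adj-sym   : ∀ {u v} → Adj u v → Adj v u
    Adj-irrefl : ∀ {u} → ¬ Adj u u

-- A finite multiset S of integers is a list;
-- its elements are the positions Fin (length S).
HasSignature : {V : Set} → Graph V → List ℤ → Set
HasSignature {V} G S =
  Σ (Fin (length S) ↔ V) λ π →
    ∀ (i j : Fin (length S)) → i ≢ j →
      Graph.Adj G (Inverse.to π i) (Inverse.to π j)
        ⇔ ((+ ∣ lookup S i - lookup S j ∣) ∈ S)

CycleAdj : (m : ℕ) → Fin m → Fin m → Set
CycleAdj m i j =
  (suc (toℕ i) ≡ toℕ j ⊎ (suc (toℕ i) ≡ m × toℕ j ≡ 0))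
  ⊎ (suc (toℕ j) ≡ toℕ i ⊎ (suc (toℕ j) ≡ m × toℕ i ≡ 0))

TwoCyclesAdj : (m : ℕ) → (Fin 2 × Fin m) → (Fin 2 × Fin m) → Set
TwoCyclesAdj m (a , i) (b , j) = a ≡ b × CycleAdj m i j

ComplTwoCyclesAdj : (m : ℕ) → (Fin 2 × Fin m) → (Fin 2 × Fin m) → Set
ComplTwoCyclesAdj m u v = u ≢ v × ¬ TwoCyclesAdj m u v

private
  open import Relation.Binary.PropositionalEquality using (sym; refl)
  open import Data.Sum using (inj₁; inj₂)

  cyc-sym : ∀ m {i j} → CycleAdj m i j → CycleAdj m j i
  cyc-sym m (inj₁ x) = inj₂ x
  cyc-sym m (inj₂ x) = inj₁ x

  two-sym : ∀ m {u v} → TwoCyclesAdj m u v → TwoCyclesAdj m v u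
  two-sym m {a , i} {b , j} (e , c) = sym e , cyc-sym m c

  compl-sym : ∀ m {u v} → ComplTwoCyclesAdj m u v → ComplTwoCyclesAdj m v u
  compl-sym m (ne , na) = (λ e → ne (sym e)) , (λ t → na (two-sym m t))

  compl-irr : ∀ m {u} → ¬ ComplTwoCyclesAdj m u u
  compl-irr m (ne , _) = ne refl

-- G_n for n = 2m: the complement of the disjoint union of two m-cycles.
Gcompl : (m : ℕ) → Graph (Fin 2 × Fin m)
Gcompl m = record
  { Adj = ComplTwoCyclesAdj m
  ; Adj-sym = compl-sym m
  ; Adj-irrefl = compl-irr m
  }

module Submission where

-- Let S be a duplicate-free list of integers containing 0 that is a signature
-- of a graph G.  Call x ≠ y in S a *gap* when |x - y| ∉ S; gaps are exactly
-- the non-edges of G.  In G_n (the complement of two n/2-cycles) every vertex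
-- has exactly two non-neighbours, so in S every element has at most two gaps
-- and 0 has two gaps a ≠ b.  Arithmetic on S then yields a contradiction:
--   * a, b < 0, since a non-negative element x of S has |0 - x| = x ∈ S;
--   * the maximum M of S has a gap to every negative element;
--   * let q be the largest element of S other than M.  If q > 0, the negative
--     element t ∈ {a, b} already has gaps to 0 and M, so q - t ∈ S, and
--     q - t > q forces q - t = M; this gives a = b.  If q ≤ 0, every negative
--     element y ∉ {a, b} has no gap to 0, so -y ∈ S and -y = M; hence
--     S ⊆ {0, a, b, M, -M}, impossible since S has 2m ≥ 8 elements.

open import Defs
open import Data.Nat as ℕ using (ℕ; suc; _≤_; _*_; z≤n; s≤s)
import Data.Nat.Properties as ℕP
open import Data.Integer as ℤ using (ℤ; +_; _-_; -_; ∣_∣)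
import Data.Integer.Properties as ℤP
open import Algebra.Bundles using (AbelianGroup)
open import Algebra.Properties.Group (AbelianGroup.group ℤP.+-0-abelianGroup) using (∙-cancelˡ)
open import Data.Fin as Fin using (Fin; toℕ; fromℕ; fromℕ<; inject₁)
import Data.Fin.Properties as FinP
open import Data.Fin.Permutation using (↔⇒≡)
open import Data.List using (List; []; _∷_; length; lookup; filter)
open import Data.List.Relation.Unary.Any as Any using (here; there)
open import Data.List.Relation.Unary.Any.Properties using (lookup-index)
open import Data.List.Relation.Unary.All as All using ()
open import Data.List.Relation.Unary.AllPairs using (_∷_)
open import Data.List.Relation.Unary.Unique.Propositional using (Unique)
open import Data.List.Relation.Binary.Subset.Propositional using (_⊆_)
open import Data.List.Membership.DecPropositional ℤ._≟_ using (_∈_; _∉_; _∈?_)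
open import Data.List.Membership.Propositional.Properties using (∈-lookup; ∈-filter⁺; ∈-filter⁻)
import Data.List.Extrema ℤP.≤-totalOrder as Extrema
open import Data.Product using (Σ; _×_; _,_; proj₁; proj₂)
open import Data.Sum using (_⊎_; inj₁; inj₂)
open import Data.Empty using (⊥; ⊥-elim)
open import Data.Unit using (⊤)
open import Function using (_∘_)
open import Function.Bundles using (Inverse; _⇔_; Equivalence)
open import Function.Properties.Inverse using (↔-trans; ↔-sym)
open import Relation.Binary.PropositionalEquality
open import Relation.Nullary using (¬_; yes; no; ¬?)
open import Relation.Unary using (Decidable)

private
  variable
    m : ℕ
    x y t t′ : ℤ
    xs ys : List ℤ

lookup-injective : Unique xs → ∀ {i j} → lookup xs i ≡ lookup xs j → i ≡ j
lookup-injective (_ ∷ _)         {Fin.zero}  {Fin.zero}  _ = refl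
lookup-injective (x∉xs ∷ _)      {Fin.zero}  {Fin.suc j} e = ⊥-elim (All.lookup x∉xs (∈-lookup j) e)
lookup-injective (x∉xs ∷ _)      {Fin.suc i} {Fin.zero}  e = ⊥-elim (All.lookup x∉xs (∈-lookup i) (sym e))
lookup-injective (_ ∷ unique-xs) {Fin.suc i} {Fin.suc j} e = cong Fin.suc (lookup-injective unique-xs e)

-- A duplicate-free list contained in another list is no longer than it:
-- sending each position to the position of its entry in ys is injective.
unique-⊆⇒length-≤ : Unique xs → xs ⊆ ys → length xs ≤ length ys
unique-⊆⇒length-≤ {xs} {ys} unique-xs xs⊆ys = FinP.injective⇒≤ position-injective
  where
  position : Fin (length xs) → Fin (length ys)
  position i = Any.index (xs⊆ys (∈-lookup i))

  entry : ∀ i → lookup ys (position i) ≡ lookup xs i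
  entry i = sym (lookup-index (xs⊆ys (∈-lookup i)))

  position-injective : ∀ {i j} → position i ≡ position j → i ≡ j
  position-injective {i} {j} e =
    lookup-injective unique-xs (trans (sym (entry i)) (trans (cong (lookup ys) e) (entry j)))

record Greatest (P : ℤ → Set) (xs : List ℤ) : Set where
  field
    value  : ℤ
    member : value ∈ xs
    holds  : P value
    bound  : ∀ {y} → y ∈ xs → P y → y ℤ.≤ value

greatest : {P : ℤ → Set} → Decidable P → x ∈ xs → P x → Greatest P xs
greatest {x} {xs} {P} P? x∈xs Px = record
  { value  = g
  ; member = proj₁ g∈xs×Pg
  ; holds  = proj₂ g∈xs×Pg
  ; bound  = λ y∈xs Py → All.lookup (Extrema.xs≤max x candidates) (∈-filter⁺ P? y∈xs Py)
  }
  where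
  candidates = filter P? xs
  g = Extrema.max x candidates

  g∈xs×Pg : g ∈ xs × P g
  g∈xs×Pg with Extrema.argmax-sel (λ z → z) x candidates
  ... | inj₁ g≡x        = subst (λ z → z ∈ xs × P z) (sym g≡x) (x∈xs , Px)
  ... | inj₂ g∈candidates = ∈-filter⁻ P? g∈candidates

distance-≤ : x ℤ.≤ y → + ∣ y - x ∣ ≡ y - x
distance-≤ x≤y = ℤP.0≤i⇒+∣i∣≡i (ℤP.i≤j⇒0≤j-i x≤y)

distance-≤′ : x ℤ.≤ y → + ∣ x - y ∣ ≡ y - x
distance-≤′ {x} {y} x≤y = trans (cong +_ (ℤP.∣i-j∣≡∣j-i∣ x y)) (distance-≤ x≤y)

<-minus-negative : t ℤ.< + 0 → y ℤ.< y - t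
<-minus-negative {t} {y} t<0 =
  subst (ℤ._< y - t) (ℤP.+-identityʳ y) (ℤP.+-monoʳ-< y (ℤP.neg-mono-< t<0))

minus-injective : ∀ y → y - t ≡ y - t′ → t ≡ t′
minus-injective y e = ℤP.neg-injective (∙-cancelˡ y _ _ e)

Gap : List ℤ → ℤ → ℤ → Set
Gap S x y = x ≢ y × + ∣ x - y ∣ ∉ S

gap-sym : ∀ {S} → Gap S x y → Gap S y x
gap-sym {x} {y} {S} (x≢y , d∉S) =
  (λ e → x≢y (sym e)) , (λ d∈S → d∉S (subst (_∈ S) (cong +_ (ℤP.∣i-j∣≡∣j-i∣ y x)) d∈S))

no-gap⇒∈ : ∀ {S} → x ≢ y → ¬ Gap S x y → + ∣ x - y ∣ ∈ S
no-gap⇒∈ {x} {y} {S} x≢y no-gap with + ∣ x - y ∣ ∈? S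
... | yes d∈S = d∈S
... | no  d∉S = ⊥-elim (no-gap (x≢y , d∉S))

AtMostTwoGaps : List ℤ → Set
AtMostTwoGaps S = ∀ {x y₁ y₂ y₃} → x ∈ S → y₁ ∈ S → y₂ ∈ S → y₃ ∈ S →
  y₁ ≢ y₂ → y₁ ≢ y₃ → y₂ ≢ y₃ → Gap S x y₁ → Gap S x y₂ → Gap S x y₃ → ⊥

module TwoGapsAtZero
  (S : List ℤ) (unique-S : Unique S) (six≤|S| : 5 ℕ.< length S)
  (at-most-two : AtMostTwoGaps S) (0∈S : + 0 ∈ S)
  {a b : ℤ} (a∈S : a ∈ S) (b∈S : b ∈ S) (a≢b : a ≢ b)
  (gap-a : Gap S (+ 0) a) (gap-b : Gap S (+ 0) b)
  where

  gap-to-0⇒negative : t ∈ S → Gap S (+ 0) t → t ℤ.< + 0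
  gap-to-0⇒negative {t} t∈S (_ , d∉S) = ℤP.≰⇒> λ 0≤t →
    d∉S (subst (_∈ S) (sym (trans (distance-≤′ 0≤t) (ℤP.+-identityʳ t))) t∈S)

  a<0 : a ℤ.< + 0
  a<0 = gap-to-0⇒negative a∈S gap-a

  module Top = Greatest (greatest {P = λ _ → ⊤} (λ _ → yes _) 0∈S _)
  M = Top.value

  0≤M : + 0 ℤ.≤ M
  0≤M = Top.bound 0∈S _

  -- The maximum has a gap to every negative element, as M - t > M.
  gap-to-top : t ℤ.< + 0 → Gap S M t
  gap-to-top {t} t<0 =
    (λ M≡t → ℤP.<⇒≱ t<0 (subst (+ 0 ℤ.≤_) M≡t 0≤M)) ,
    (λ d∈S → ℤP.<⇒≱ (<-minus-negative t<0)
               (Top.bound (subst (_∈ S) (distance-≤ (ℤP.≤-trans (ℤP.<⇒≤ t<0) 0≤M)) d∈S) _))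

  module Second = Greatest (greatest (λ z → ¬? (z ℤ.≟ M)) a∈S
                            (λ a≡M → ℤP.<⇒≱ a<0 (subst (+ 0 ℤ.≤_) (sym a≡M) 0≤M)))
  q = Second.value

  above-second⇒top : y ∈ S → q ℤ.< y → y ≡ M
  above-second⇒top {y} y∈S q<y with y ℤ.≟ M
  ... | yes y≡M = y≡M
  ... | no  y≢M = ⊥-elim (ℤP.<⇒≱ q<y (Second.bound y∈S y≢M))

  -- If q > 0, every t with a gap to 0 satisfies q - t = M: t already has
  -- gaps to 0 and M, so it has none to q, and q - t > q.
  reflection-through-second : + 0 ℤ.< q → t ∈ S → Gap S (+ 0) t → q - t ≡ M
  reflection-through-second {t} 0<q t∈S gap-t =
    above-second⇒top (subst (_∈ S) (distance-≤′ t≤q) (no-gap⇒∈ t≢q no-gap-to-q))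
                     (<-minus-negative t<0)
    where
    t<0 = gap-to-0⇒negative t∈S gap-t
    t≤q = ℤP.<⇒≤ (ℤP.<-trans t<0 0<q)
    t≢q = ℤP.<⇒≢ (ℤP.<-trans t<0 0<q)
    0<M = ℤP.<-≤-trans 0<q (Top.bound Second.member _)
    no-gap-to-q : ¬ Gap S t q
    no-gap-to-q gap-q =
      at-most-two t∈S 0∈S Top.member Second.member
        (ℤP.<⇒≢ 0<M) (ℤP.<⇒≢ 0<q) (λ M≡q → Second.holds (sym M≡q))
        (gap-sym gap-t) (gap-sym (gap-to-top t<0)) gap-q

  positive-second : ¬ (+ 0 ℤ.< q)
  positive-second 0<q = a≢b (minus-injective q
    (trans (reflection-through-second 0<q a∈S gap-a) (sym (reflection-through-second 0<q b∈S gap-b))))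

  -- If q ≤ 0, an element y ∉ {0, a, b, M} is negative and has no gap to 0
  -- (0 already has the gaps a, b), so -y ∈ S and -y > q forces y = -M.
  reflection-through-zero : q ℤ.≤ + 0 → y ∈ S → y ≢ + 0 → y ≢ a → y ≢ b → y ≢ M → y ≡ - M
  reflection-through-zero {y} q≤0 y∈S y≢0 y≢a y≢b y≢M =
    trans (sym (ℤP.neg-involutive y)) (cong -_ -y≡M)
    where
    y<0 : y ℤ.< + 0
    y<0 = ℤP.≤∧≢⇒< (ℤP.≤-trans (Second.bound y∈S y≢M) q≤0) y≢0
    no-gap-to-y : ¬ Gap S (+ 0) y
    no-gap-to-y = at-most-two 0∈S a∈S b∈S y∈S a≢b (y≢a ∘ sym) (y≢b ∘ sym) gap-a gap-b
    -y∈S : - y ∈ S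
    -y∈S = subst (_∈ S) (trans (distance-≤ (ℤP.<⇒≤ y<0)) (ℤP.+-identityˡ (- y)))
                 (no-gap⇒∈ (y≢0 ∘ sym) no-gap-to-y)
    -y≡M : - y ≡ M
    -y≡M = above-second⇒top -y∈S (ℤP.≤-<-trans q≤0 (ℤP.neg-mono-< y<0))

  small-support : q ℤ.≤ + 0 → S ⊆ (+ 0 ∷ a ∷ b ∷ M ∷ - M ∷ [])
  small-support q≤0 {y} y∈S with y ℤ.≟ + 0 | y ℤ.≟ a | y ℤ.≟ b | y ℤ.≟ M
  ... | yes y≡0 | _       | _       | _       = here y≡0
  ... | no  _   | yes y≡a | _       | _       = there (here y≡a)
  ... | no  _   | no  _   | yes y≡b | _       = there (there (here y≡b))
  ... | no  _   | no  _   | no  _   | yes y≡M = there (there (there (here y≡M)))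
  ... | no  y≢0 | no  y≢a | no  y≢b | no  y≢M =
    there (there (there (there (here (reflection-through-zero q≤0 y∈S y≢0 y≢a y≢b y≢M)))))

  nonpositive-second : ¬ (q ℤ.≤ + 0)
  nonpositive-second q≤0 = ℕP.<⇒≱ six≤|S| (unique-⊆⇒length-≤ unique-S (small-support q≤0))

  contradiction : ⊥
  contradiction = positive-second (ℤP.≰⇒> nonpositive-second)

NonAdj : {V : Set} → Graph V → V → V → Set
NonAdj G u v = u ≢ v × ¬ Graph.Adj G u v

AtMostTwoNonNeighbours : {V : Set} → Graph V → Set
AtMostTwoNonNeighbours {V} G = ∀ {u v₁ v₂ v₃ : V} → v₁ ≢ v₂ → v₁ ≢ v₃ → v₂ ≢ v₃ →
  NonAdj G u v₁ → NonAdj G u v₂ → NonAdj G u v₃ → ⊥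

TwoNonNeighbours : {V : Set} → Graph V → V → Set
TwoNonNeighbours {V} G u = Σ V λ v₁ → Σ V λ v₂ → v₁ ≢ v₂ × NonAdj G u v₁ × NonAdj G u v₂

-- Through a duplicate-free signature S of G, vertices are labelled by the
-- elements of S, and non-neighbours correspond exactly to gaps.
module SignatureLabels {V : Set} (G : Graph V) (S : List ℤ) (unique-S : Unique S)
                       (signature : HasSignature G S) where
  open Graph G
  open Inverse (proj₁ signature)

  label : V → ℤ
  label v = lookup S (from v)

  label∈S : ∀ v → label v ∈ S
  label∈S v = ∈-lookup (from v)

  vertex : x ∈ S → V
  vertex x∈S = to (Any.index x∈S)

  label-vertex : (x∈S : x ∈ S) → label (vertex x∈S) ≡ x
  label-vertex x∈S = trans (cong (lookup S) (strictlyInverseʳ (Any.index x∈S)))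
                           (sym (lookup-index x∈S))

  label-injective : ∀ {u v} → label u ≡ label v → u ≡ v
  label-injective {u} {v} e =
    trans (sym (strictlyInverseˡ u)) (trans (cong to (lookup-injective unique-S e)) (strictlyInverseˡ v))

  vertex-injective : (x∈S : x ∈ S) (y∈S : y ∈ S) → vertex x∈S ≡ vertex y∈S → x ≡ y
  vertex-injective x∈S y∈S e = trans (sym (label-vertex x∈S)) (trans (cong label e) (label-vertex y∈S))

  adjacency : ∀ {u v} → u ≢ v → Adj u v ⇔ (+ ∣ label u - label v ∣ ∈ S)
  adjacency {u} {v} u≢v =
    subst₂ (λ u′ v′ → Adj u′ v′ ⇔ (+ ∣ label u - label v ∣ ∈ S))
           (strictlyInverseˡ u) (strictlyInverseˡ v)
           (proj₂ signature (from u) (from v) (λ e → u≢v (label-injective (cong (lookup S) e))))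

  non-adj⇒gap : ∀ {u v} → NonAdj G u v → Gap S (label u) (label v)
  non-adj⇒gap (u≢v , ¬adj) = (u≢v ∘ label-injective) , (¬adj ∘ Equivalence.from (adjacency u≢v))

  gap⇒non-adj : (x∈S : x ∈ S) (y∈S : y ∈ S) → Gap S x y → NonAdj G (vertex x∈S) (vertex y∈S)
  gap⇒non-adj {x} {y} x∈S y∈S (x≢y , d∉S) =
    distinct , λ adj → d∉S (subst (_∈ S) (cong₂ (λ x′ y′ → + ∣ x′ - y′ ∣) (label-vertex x∈S) (label-vertex y∈S))
                                   (Equivalence.to (adjacency distinct) adj))
    where
    distinct : vertex x∈S ≢ vertex y∈S
    distinct = x≢y ∘ vertex-injective x∈S y∈S

  at-most-two-gaps : AtMostTwoNonNeighbours G → AtMostTwoGaps S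
  at-most-two-gaps at-most-two x∈S y₁∈S y₂∈S y₃∈S y₁≢y₂ y₁≢y₃ y₂≢y₃ gap₁ gap₂ gap₃ =
    at-most-two (y₁≢y₂ ∘ vertex-injective y₁∈S y₂∈S) (y₁≢y₃ ∘ vertex-injective y₁∈S y₃∈S)
                (y₂≢y₃ ∘ vertex-injective y₂∈S y₃∈S)
                (gap⇒non-adj x∈S y₁∈S gap₁) (gap⇒non-adj x∈S y₂∈S gap₂) (gap⇒non-adj x∈S y₃∈S gap₃)

no-signature-with-zero : {V : Set} (G : Graph V) →
  AtMostTwoNonNeighbours G → (∀ u → TwoNonNeighbours G u) →
  (S : List ℤ) → Unique S → + 0 ∈ S → 5 ℕ.< length S → ¬ HasSignature G S
no-signature-with-zero G at-most-two two S unique-S 0∈S six≤|S| signature =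
  from-non-neighbours (two (vertex 0∈S))
  where
  open SignatureLabels G S unique-S signature

  gap-at-zero : ∀ {v} → NonAdj G (vertex 0∈S) v → Gap S (+ 0) (label v)
  gap-at-zero non-adj = subst (λ z → Gap S z (label _)) (label-vertex 0∈S) (non-adj⇒gap non-adj)

  from-non-neighbours : TwoNonNeighbours G (vertex 0∈S) → ⊥
  from-non-neighbours (v₁ , v₂ , v₁≢v₂ , non-adj₁ , non-adj₂) =
    TwoGapsAtZero.contradiction S unique-S six≤|S| (at-most-two-gaps at-most-two) 0∈S
      (label∈S v₁) (label∈S v₂) (v₁≢v₂ ∘ label-injective)
      (gap-at-zero non-adj₁) (gap-at-zero non-adj₂)

-- j follows i on the m-cycle 0 → 1 → ⋯ → m-1 → 0; cycle adjacency is
-- following in either direction, so CycleAdj m i j = Succ m i j ⊎ Succ m j i.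
Succ : (m : ℕ) → Fin m → Fin m → Set
Succ m i j = suc (toℕ i) ≡ toℕ j ⊎ (suc (toℕ i) ≡ m × toℕ j ≡ 0)

succ-functional : ∀ {i j j′ : Fin m} → Succ m i j → Succ m i j′ → j ≡ j′
succ-functional (inj₁ e) (inj₁ e′) = FinP.toℕ-injective (trans (sym e) e′)
succ-functional (inj₂ (_ , j≡0)) (inj₂ (_ , j′≡0)) = FinP.toℕ-injective (trans j≡0 (sym j′≡0))
succ-functional {j = j} (inj₁ e) (inj₂ (e′ , _)) = ⊥-elim (ℕP.<⇒≢ (FinP.toℕ<n j) (trans (sym e) e′))
succ-functional {j′ = j′} (inj₂ (e , _)) (inj₁ e′) = ⊥-elim (ℕP.<⇒≢ (FinP.toℕ<n j′) (trans (sym e′) e))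

succ-injective : ∀ {i i′ j : Fin m} → Succ m i j → Succ m i′ j → i ≡ i′
succ-injective (inj₁ e) (inj₁ e′) = FinP.toℕ-injective (ℕP.suc-injective (trans e (sym e′)))
succ-injective (inj₂ (e , _)) (inj₂ (e′ , _)) = FinP.toℕ-injective (ℕP.suc-injective (trans e (sym e′)))
succ-injective (inj₁ e) (inj₂ (_ , j≡0)) = ⊥-elim (ℕP.1+n≢0 (trans e j≡0))
succ-injective (inj₂ (_ , j≡0)) (inj₁ e′) = ⊥-elim (ℕP.1+n≢0 (trans e′ j≡0))

successor : (i : Fin m) → Σ (Fin m) (Succ m i)
successor {m} i with suc (toℕ i) ℕP.<? m
... | yes i+1<m = fromℕ< i+1<m , inj₁ (sym (FinP.toℕ-fromℕ< i+1<m))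
successor {suc _} i | no i+1≮m =
  Fin.zero , inj₂ (ℕP.≤-antisym (FinP.toℕ<n i) (ℕP.≮⇒≥ i+1≮m) , refl)

predecessor : (i : Fin m) → Σ (Fin m) λ j → Succ m j i
predecessor {suc m} Fin.zero    = fromℕ m , inj₂ (cong suc (FinP.toℕ-fromℕ m) , refl)
predecessor         (Fin.suc i) = inject₁ i , inj₁ (cong suc (FinP.toℕ-inject₁ i))

succ-loop : ∀ {i : Fin m} → Succ m i i → m ≤ 1
succ-loop (inj₁ e) = ⊥-elim (ℕP.1+n≢n e)
succ-loop (inj₂ (e , i≡0)) = ℕP.≤-reflexive (trans (sym e) (cong suc i≡0))

succ-2-cycle : ∀ {i j : Fin m} → Succ m i j → Succ m j i → m ≤ 2
succ-2-cycle (inj₁ e) (inj₁ e′) = ⊥-elim (ℕP.<-asym (ℕP.≤-reflexive e) (ℕP.≤-reflexive e′))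
succ-2-cycle (inj₁ e) (inj₂ (e′ , i≡0)) =
  ℕP.≤-reflexive (trans (sym e′) (cong suc (trans (sym e) (cong suc i≡0))))
succ-2-cycle (inj₂ (e , j≡0)) (inj₁ e′) =
  ℕP.≤-reflexive (trans (sym e) (cong suc (trans (sym e′) (cong suc j≡0))))
succ-2-cycle (inj₂ (e , _)) (inj₂ (_ , i≡0)) = ℕP.m≤n⇒m≤1+n (ℕP.≤-reflexive (trans (sym e) (cong suc i≡0)))

-- A vertex of a cycle has at most two neighbours: each neighbour is its
-- unique successor or its unique predecessor.
cycle-at-most-two : ∀ {x y₁ y₂ y₃ : Fin m} →
  CycleAdj m x y₁ → CycleAdj m x y₂ → CycleAdj m x y₃ → y₁ ≢ y₂ → y₁ ≢ y₃ → y₂ ≢ y₃ → ⊥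
cycle-at-most-two (inj₁ s₁) (inj₁ s₂) _         y₁≢y₂ _     _     = y₁≢y₂ (succ-functional s₁ s₂)
cycle-at-most-two (inj₂ p₁) (inj₂ p₂) _         y₁≢y₂ _     _     = y₁≢y₂ (succ-injective p₁ p₂)
cycle-at-most-two (inj₁ s₁) (inj₂ _)  (inj₁ s₃) _     y₁≢y₃ _     = y₁≢y₃ (succ-functional s₁ s₃)
cycle-at-most-two (inj₁ _)  (inj₂ p₂) (inj₂ p₃) _     _     y₂≢y₃ = y₂≢y₃ (succ-injective p₂ p₃)
cycle-at-most-two (inj₂ _)  (inj₁ s₂) (inj₁ s₃) _     _     y₂≢y₃ = y₂≢y₃ (succ-functional s₂ s₃)
cycle-at-most-two (inj₂ p₁) (inj₁ _)  (inj₂ p₃) _     y₁≢y₃ _     = y₁≢y₃ (succ-injective p₁ p₃)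

-- The same holds in the disjoint union of two cycles: neighbours lie in the
-- same copy.
two-cycles-at-most-two : ∀ {u v₁ v₂ v₃} →
  TwoCyclesAdj m u v₁ → TwoCyclesAdj m u v₂ → TwoCyclesAdj m u v₃ → v₁ ≢ v₂ → v₁ ≢ v₃ → v₂ ≢ v₃ → ⊥
two-cycles-at-most-two {u = c , _} (refl , adj₁) (refl , adj₂) (refl , adj₃) v₁≢v₂ v₁≢v₃ v₂≢v₃ =
  cycle-at-most-two adj₁ adj₂ adj₃ (v₁≢v₂ ∘ cong (c ,_)) (v₁≢v₃ ∘ cong (c ,_)) (v₂≢v₃ ∘ cong (c ,_))

-- Non-neighbours in the complement are (up to double negation) neighbours
-- in the two cycles; since the goal is ⊥, the double negations can be used.
compl-non-adj : ∀ {u v} → NonAdj (Gcompl m) u v → ¬ ¬ TwoCyclesAdj m u v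
compl-non-adj (u≢v , ¬adj) ¬two = ¬adj (u≢v , ¬two)

compl-at-most-two : AtMostTwoNonNeighbours (Gcompl m)
compl-at-most-two v₁≢v₂ v₁≢v₃ v₂≢v₃ non-adj₁ non-adj₂ non-adj₃ =
  compl-non-adj non-adj₁ λ two₁ → compl-non-adj non-adj₂ λ two₂ → compl-non-adj non-adj₃ λ two₃ →
  two-cycles-at-most-two two₁ two₂ two₃ v₁≢v₂ v₁≢v₃ v₂≢v₃

-- For m ≥ 3 the successor and the predecessor of a vertex are two distinct
-- non-neighbours in the complement.
compl-two-non-neighbours : 3 ≤ m → ∀ u → TwoNonNeighbours (Gcompl m) u
compl-two-non-neighbours {m} 3≤m (c , i) with successor i | predecessor i
... | j , i→j | k , k→i =
  (c , j) , (c , k) , j≢k ,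
  (no-loop ∘ (λ i≡j → subst (Succ m i) (sym i≡j) i→j) ∘ cong proj₂ , cycle-edge (refl , inj₁ i→j)) ,
  (no-loop ∘ (λ i≡k → subst (λ l → Succ m l i) (sym i≡k) k→i) ∘ cong proj₂ , cycle-edge (refl , inj₂ k→i))
  where
  no-loop : ¬ Succ m i i
  no-loop = ℕP.<⇒≱ (ℕP.<-trans (s≤s (s≤s z≤n)) 3≤m) ∘ succ-loop

  j≢k : (c , j) ≢ (c , k)
  j≢k e = ℕP.<⇒≱ 3≤m (succ-2-cycle i→j (subst (λ l → Succ m l i) (sym (cong proj₂ e)) k→i))

  cycle-edge : ∀ {v} → TwoCyclesAdj m (c , i) v → ¬ ComplTwoCyclesAdj m (c , i) v
  cycle-edge two (_ , ¬two) = ¬two two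

compl-signature-length : ∀ {S} → HasSignature (Gcompl m) S → length S ≡ 2 * m
compl-signature-length (π , _) = ↔⇒≡ (↔-trans π (↔-sym FinP.*↔×))

-- Lemma 7: for n = 2m ≥ 8, G_n has m ≥ 3 and at least six vertices, and every
-- vertex has exactly two non-neighbours.
lemma7 : (n m : ℕ) → 8 ≤ n → n ≡ 2 * m →
         (S : List ℤ) → Unique S → (+ 0) ∈ S →
         ¬ HasSignature (Gcompl m) S
lemma7 n m 8≤n n≡2m S unique-S 0∈S signature =
  no-signature-with-zero (Gcompl m) compl-at-most-two (compl-two-non-neighbours 3≤m)
    S unique-S 0∈S six≤|S| signature
  where
  8≤|S| : 8 ≤ length S
  8≤|S| = subst (8 ≤_) (trans n≡2m (sym (compl-signature-length signature))) 8≤n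

  six≤|S| : 5 ℕ.< length S
  six≤|S| = ℕP.≤-trans (ℕP.m≤n+m 6 2) 8≤|S|

  3≤m : 3 ≤ m
  3≤m = ℕP.≤-trans (ℕP.n≤1+n 3) (ℕP.*-cancelˡ-≤ 2 (subst (8 ≤_) n≡2m 8≤n))
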